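{- Let $\mathbb{Q}^{+}$ be ordered by the Calkin-Wilf tree enumeration $q_1,q_2,q_3,\dots$. Then $\mathbb{Q}^{+}$ is partitioned into the three parity classes $\mathbb{Q}_\mathrm{E}^{+}$, $\mathbb{Q}_\mathrm{O}^{+}$ and $\mathbb{Q}_\mathrm{N}^{+}$, and each of these has asymptotic density $\frac{1}{3}$ in $\mathbb{Q}^+$ with respect to this ordering.
   Context: Write each rational in lowest terms $m/n$ with $n>0$, $\gcd(m,n)=1$. Its parity is: even if $m$ is even (hence $n$ odd); odd if $m$ and $n$ are both odd; none if $n$ is even (hence $m$ odd). $\mathbb{Q}_\mathrm{E}^{+},\mathbb{Q}_\mathrm{O}^{+},\mathbb{Q}_\mathrm{N}^{+}$ are the sets of positive rationals of parity even, odd, none respectively. The Calkin-Wilf tree is the infinite binary tree with root $1/1$ in which each vertex $m/n$ has left child $m/(m+n)$ and right child $(m+n)/n$; every positive rational occurs exactly once. The Calkin-Wilf enumeration lists the tree row by row (row $0$ is the root, row $r$ has $2^r$ entries), each row from left to right. For a countable set $X$ enumerated as $x_1,x_2,\dots$ and $A\subseteq X$, the asymptotic density of $A$ in $X$ is $\rho_X(A)=\lim_{n\to\infty}|A\cap\{x_1,\dots,x_n\}|/n$ when the limit exists. -}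

module Defs where

open import Data.Nat using (ℕ; zero; suc; _+_)
open import Data.Nat.Divisibility using (_∣_; _∣?_)
open import Data.Integer using (+_)
import Data.Integer as ℤ
open import Data.Rational using (ℚ; _/_; ↥_; ↧ₙ_)
open import Data.Product using (_×_; _,_)
open import Data.List using (List; []; _∷_; _++_; concatMap; filter; take; length)
open import Relation.Nullary using (¬_)
open import Relation.Nullary.Decidable using (¬?; _×-dec_)
open import Relation.Unary using (Pred; Decidable)
open import Level using (0ℓ)

-- Parity classes of a rational written in lowest terms m/n (Data.Rational
-- stores every rational in lowest terms with positive denominator).
IsEvenQ : Pred ℚ 0ℓ
IsEvenQ q = 2 ∣ ℤ.∣ ↥ q ∣

IsOddQ : Pred ℚ 0ℓ
IsOddQ q = ¬ (2 ∣ ℤ.∣ ↥ q ∣) × ¬ (2 ∣ ↧ₙ q)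

IsNoneQ : Pred ℚ 0ℓ
IsNoneQ q = 2 ∣ ↧ₙ q

isEvenQ? : Decidable IsEvenQ
isEvenQ? q = 2 ∣? ℤ.∣ ↥ q ∣

isOddQ? : Decidable IsOddQ
isOddQ? q = ¬? (2 ∣? ℤ.∣ ↥ q ∣) ×-dec ¬? (2 ∣? ↧ₙ q)

isNoneQ? : Decidable IsNoneQ
isNoneQ? q = 2 ∣? ↧ₙ q

-- Calkin-Wilf tree vertices: the pair (a , b) stands for the fraction
-- (a+1)/(b+1), so that numerator and denominator are positive.
CWNode : Set
CWNode = ℕ × ℕ

nodeℚ : CWNode → ℚ
nodeℚ (a , b) = + suc a / suc b

-- m/n ↦ left child m/(m+n), right child (m+n)/n.
-- With m = a+1, n = b+1: m+n = suc (a + suc b).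
leftChild : CWNode → CWNode
leftChild (a , b) = (a , a + suc b)

rightChild : CWNode → CWNode
rightChild (a , b) = (a + suc b , b)

cwRow : ℕ → List CWNode
cwRow zero    = (0 , 0) ∷ []
cwRow (suc r) = concatMap (λ v → leftChild v ∷ rightChild v ∷ []) (cwRow r)

cwRowsUpTo : ℕ → List CWNode
cwRowsUpTo zero    = cwRow zero
cwRowsUpTo (suc r) = cwRowsUpTo r ++ cwRow (suc r)

-- The first n terms q_1, ..., q_n of the Calkin-Wilf enumeration
-- (rows 0..n contain 2^(n+1) - 1 ≥ n entries).
cwPrefix : ℕ → List ℚ
cwPrefix n = Data.List.map nodeℚ (take n (cwRowsUpTo n))

countIn : {P : Pred ℚ 0ℓ} → Decidable P → ℕ → ℕ
countIn P? n = length (filter P? (cwPrefix n))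

module Submission where

-- The parity of a Calkin-Wilf vertex determines those of its children: m/(m+n) swaps
-- odd and none and fixes even, and (m+n)/n is always one step further than m/(m+n)
-- in the cycle odd → none → even → odd.  Hence if a row runs through this cycle, so
-- does the next one, and, by induction from the root, each row resumes the cycle where
-- the previous row left it.  As the root 1/1 is odd, the enumeration reads odd, none,
-- even, odd, …, so among the first n terms each class occurs n/3 times up to 2/3.

open import Defs
open import Data.Nat using (ℕ; suc; _≤_)
open import Data.Integer using (+_)
open import Data.Rational using (ℚ; _/_; _-_; ∣_∣; _<_; Positive)
open import Data.Product using (_×_; ∃-syntax)
open import Data.Sum using (_⊎_)
open import Relation.Nullary using (¬_)

open import Data.Nat using (zero; _+_; _*_; z≤n; s≤s) renaming (_<_ to _<ℕ_)
import Data.Nat.Properties as ℕ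
open import Data.Nat.Divisibility using (_∣_; _∤_; divides; n∣n; ∣m∣n⇒∣m+n; ∣m+n∣m⇒∣n; ∣1⇒≡1)
open import Data.Nat.Coprimality as Coprime using (Coprime; coprime-+)
import Data.Integer as ℤ
import Data.Integer.Properties as ℤ
open import Data.Rational using (mkℚ; toℚᵘ; -_)
import Data.Rational.Properties as ℚ
import Data.Rational.Unnormalised as ℚᵘ
import Data.Rational.Unnormalised.Properties as ℚᵘ
open import Data.Product using (_,_; proj₁; proj₂)
open import Data.Sum using (inj₁; inj₂)
open import Data.Empty using (⊥-elim)
open import Data.List using (List; []; _∷_; _++_; concatMap; filter; take; length; map)
open import Data.List.Properties using (length-++)
open import Function using (_∘_; _⇔_; mk⇔; Equivalence)
open import Relation.Nullary using (yes; no)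
open import Relation.Unary using (Pred; Decidable)
open import Relation.Binary.PropositionalEquality
open import Level using (0ℓ)

2∤⇒2∣suc : ∀ {m} → 2 ∤ m → 2 ∣ suc m
2∤⇒2∣suc {zero}        2∤0   = ⊥-elim (2∤0 (divides 0 refl))
2∤⇒2∣suc {suc zero}    _     = n∣n
2∤⇒2∣suc {suc (suc m)} 2∤2+m = ∣m∣n⇒∣m+n n∣n (2∤⇒2∣suc (2∤2+m ∘ ∣m∣n⇒∣m+n n∣n))

odd+odd⇒even : ∀ {m n} → 2 ∤ m → 2 ∤ n → 2 ∣ m + n
odd+odd⇒even {m} {n} 2∤m 2∤n = ∣m+n∣m⇒∣n (subst (2 ∣_) (cong suc (ℕ.+-suc m n)) 2∣sm+sn) n∣n
  where
  2∣sm+sn : 2 ∣ suc m + suc n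
  2∣sm+sn = ∣m∣n⇒∣m+n (2∤⇒2∣suc 2∤m) (2∤⇒2∣suc 2∤n)

even+odd⇒odd : ∀ {m n} → 2 ∣ m → 2 ∤ n → 2 ∤ m + n
even+odd⇒odd 2∣m 2∤n 2∣m+n = 2∤n (∣m+n∣m⇒∣n 2∣m+n 2∣m)

odd+even⇒odd : ∀ {m n} → 2 ∤ m → 2 ∣ n → 2 ∤ m + n
odd+even⇒odd {m} {n} 2∤m 2∣n = subst (2 ∤_) (ℕ.+-comm n m) (even+odd⇒odd 2∣n 2∤m)

data Parity : Set where
  odd none even : Parity

HasParity : Parity → ℕ → ℕ → Set
HasParity odd  m n = 2 ∤ m × 2 ∤ n
HasParity none m n = 2 ∤ m × 2 ∣ n
HasParity even m n = 2 ∣ m × 2 ∤ n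

next : Parity → Parity
next odd  = none
next none = even
next even = odd

leftParity : Parity → Parity
leftParity odd  = none
leftParity none = odd
leftParity even = even

next∘next∘leftParity : ∀ p → next (next (leftParity p)) ≡ leftParity (next p)
next∘next∘leftParity odd  = refl
next∘next∘leftParity none = refl
next∘next∘leftParity even = refl

hasParity-left : ∀ p {m n} → HasParity p m n → HasParity (leftParity p) m (m + n)
hasParity-left odd  (2∤m , 2∤n) = 2∤m , odd+odd⇒even 2∤m 2∤n
hasParity-left none (2∤m , 2∣n) = 2∤m , odd+even⇒odd 2∤m 2∣n
hasParity-left even (2∣m , 2∤n) = 2∣m , even+odd⇒odd 2∣m 2∤n

hasParity-right : ∀ p {m n} → HasParity p m n → HasParity (next (leftParity p)) (m + n) n
hasParity-right odd  (2∤m , 2∤n) = odd+odd⇒even 2∤m 2∤n , 2∤n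
hasParity-right none (2∤m , 2∣n) = odd+even⇒odd 2∤m 2∣n , 2∣n
hasParity-right even (2∣m , 2∤n) = even+odd⇒odd 2∣m 2∤n , 2∤n

hasParity-even : ∀ p {m n} → HasParity p m n → 2 ∣ m ⇔ p ≡ even
hasParity-even odd  (2∤m , _) = mk⇔ (λ 2∣m → ⊥-elim (2∤m 2∣m)) λ ()
hasParity-even none (2∤m , _) = mk⇔ (λ 2∣m → ⊥-elim (2∤m 2∣m)) λ ()
hasParity-even even (2∣m , _) = mk⇔ (λ _ → refl) λ _ → 2∣m

hasParity-odd : ∀ p {m n} → HasParity p m n → (2 ∤ m × 2 ∤ n) ⇔ p ≡ odd
hasParity-odd odd  h         = mk⇔ (λ _ → refl) λ _ → h
hasParity-odd none (_ , 2∣n) = mk⇔ (λ h → ⊥-elim (proj₂ h 2∣n)) λ ()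
hasParity-odd even (2∣m , _) = mk⇔ (λ h → ⊥-elim (proj₁ h 2∣m)) λ ()

hasParity-none : ∀ p {m n} → HasParity p m n → 2 ∣ n ⇔ p ≡ none
hasParity-none odd  (_ , 2∤n) = mk⇔ (λ 2∣n → ⊥-elim (2∤n 2∣n)) λ ()
hasParity-none none (_ , 2∣n) = mk⇔ (λ _ → refl) λ _ → 2∣n
hasParity-none even (_ , 2∤n) = mk⇔ (λ 2∣n → ⊥-elim (2∤n 2∣n)) λ ()

NodeParity : Parity → CWNode → Set
NodeParity p (a , b) = Coprime (suc a) (suc b) × HasParity p (suc a) (suc b)

leftChild-parity : ∀ p v → NodeParity p v → NodeParity (leftParity p) (leftChild v)
leftChild-parity p (a , b) (cop , h) = Coprime.sym (coprime-+ (Coprime.sym cop)) , hasParity-left p h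

rightChild-parity : ∀ p v → NodeParity p v → NodeParity (next (leftParity p)) (rightChild v)
rightChild-parity p (a , b) (cop , h) =
  subst (λ m → Coprime m (suc b)) (ℕ.+-comm (suc b) (suc a)) (coprime-+ cop) , hasParity-right p h

Cyclic : Parity → List CWNode → Parity → Set
Cyclic p []       q = p ≡ q
Cyclic p (v ∷ vs) q = NodeParity p v × Cyclic (next p) vs q

children : CWNode → List CWNode
children v = leftChild v ∷ rightChild v ∷ []

cyclic-children : ∀ p vs q → Cyclic p vs q →
  Cyclic (leftParity p) (concatMap children vs) (leftParity q)
cyclic-children p []       q refl     = refl
cyclic-children p (v ∷ vs) q (h , hs) = leftChild-parity p v h , rightChild-parity p v h ,
  subst (λ r → Cyclic r (concatMap children vs) (leftParity q)) (sym (next∘next∘leftParity p))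
    (cyclic-children (next p) vs q hs)

cyclic-++ : ∀ p vs q ws r → Cyclic p vs q → Cyclic q ws r → Cyclic p (vs ++ ws) r
cyclic-++ p []       q ws r refl     hs′ = hs′
cyclic-++ p (v ∷ vs) q ws r (h , hs) hs′ = h , cyclic-++ (next p) vs q ws r hs hs′

rowStart : ℕ → Parity
rowStart zero    = odd
rowStart (suc r) = leftParity (rowStart r)

cyclic-cwRow : ∀ r → Cyclic (rowStart r) (cwRow r) (rowStart (suc r))
cyclic-cwRow zero    = (Coprime.1-coprimeTo 1 , 1∤1 , 1∤1) , refl
  where
  1∤1 : 2 ∤ 1
  1∤1 2∣1 with ∣1⇒≡1 2∣1
  ... | ()
cyclic-cwRow (suc r) = cyclic-children (rowStart r) (cwRow r) (rowStart (suc r)) (cyclic-cwRow r)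

cyclic-cwRowsUpTo : ∀ r → Cyclic odd (cwRowsUpTo r) (rowStart (suc r))
cyclic-cwRowsUpTo zero    = cyclic-cwRow zero
cyclic-cwRowsUpTo (suc r) = cyclic-++ odd (cwRowsUpTo r) (rowStart (suc r)) (cwRow (suc r)) _
  (cyclic-cwRowsUpTo r) (cyclic-cwRow (suc r))

indicator : Parity → Parity → ℕ
indicator odd  odd  = 1
indicator none none = 1
indicator even even = 1
indicator _    _    = 0

indicator-≡ : ∀ X → indicator X X ≡ 1
indicator-≡ odd  = refl
indicator-≡ none = refl
indicator-≡ even = refl

indicator-≢ : ∀ X p → p ≢ X → indicator X p ≡ 0
indicator-≢ odd  odd  p≢X = ⊥-elim (p≢X refl)
indicator-≢ odd  none _   = refl
indicator-≢ odd  even _   = refl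
indicator-≢ none odd  _   = refl
indicator-≢ none none p≢X = ⊥-elim (p≢X refl)
indicator-≢ none even _   = refl
indicator-≢ even odd  _   = refl
indicator-≢ even none _   = refl
indicator-≢ even even p≢X = ⊥-elim (p≢X refl)

occurrences : Parity → Parity → ℕ → ℕ
occurrences X p zero    = 0
occurrences X p (suc n) = indicator X p + occurrences X (next p) n

occurrences-mono : ∀ X p n → occurrences X p n ≤ occurrences X p (suc n)
occurrences-mono X p zero    = z≤n
occurrences-mono X p (suc n) = ℕ.+-monoʳ-≤ (indicator X p) (occurrences-mono X (next p) n)

occurrences-period : ∀ X p n → occurrences X p (3 + n) ≡ suc (occurrences X p n)
occurrences-period odd  odd  n = refl
occurrences-period odd  none n = refl
occurrences-period odd  even n = refl
occurrences-period none odd  n = refl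
occurrences-period none none n = refl
occurrences-period none even n = refl
occurrences-period even odd  n = refl
occurrences-period even none n = refl
occurrences-period even even n = refl

NearThird : ℕ → ℕ → Set
NearThird n c = n ≤ 2 + c * 3 × c * 3 ≤ 2 + n

nearThird-of-period : (f : ℕ → ℕ) → f 0 ≡ 0 → (∀ n → f n ≤ f (suc n)) →
  (∀ n → f (3 + n) ≡ suc (f n)) → ∀ n → NearThird n (f n)
nearThird-of-period f f0 mono period = go
  where
  f2≤1 : f 2 ≤ 1
  f2≤1 = ℕ.≤-trans (mono 2) (ℕ.≤-reflexive (trans (period 0) (cong suc f0)))

  f1≤1 : f 1 ≤ 1
  f1≤1 = ℕ.≤-trans (mono 1) f2≤1

  go : ∀ n → NearThird n (f n)
  go zero                = z≤n , ℕ.≤-trans (ℕ.≤-reflexive (cong (_* 3) f0)) z≤n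
  go (suc zero)          = s≤s z≤n , ℕ.*-monoˡ-≤ 3 f1≤1
  go (suc (suc zero))    = s≤s (s≤s z≤n) , ℕ.≤-trans (ℕ.*-monoˡ-≤ 3 f2≤1) (ℕ.n≤1+n 3)
  go (suc (suc (suc n))) rewrite period n with go n
  ... | lower , upper = s≤s (s≤s (s≤s lower)) , s≤s (s≤s (s≤s upper))

occurrences-nearThird : ∀ X p n → NearThird n (occurrences X p n)
occurrences-nearThird X p =
  nearThird-of-period (occurrences X p) refl (occurrences-mono X p) (occurrences-period X p)

Classifies : Pred ℚ 0ℓ → Parity → Set
Classifies P X = ∀ p v → NodeParity p v → P (nodeℚ v) ⇔ p ≡ X

length-filter-cyclic : {P : Pred ℚ 0ℓ} (P? : Decidable P) (X : Parity) → Classifies P X →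
  ∀ n p vs q → Cyclic p vs q → n ≤ length vs →
  length (filter P? (map nodeℚ (take n vs))) ≡ occurrences X p n
length-filter-cyclic P? X cl zero    p vs       q _        _         = refl
length-filter-cyclic P? X cl (suc n) p (v ∷ vs) q (h , hs) (s≤s n≤) with P? (nodeℚ v)
... | yes Pv rewrite Equivalence.to (cl p v h) Pv | indicator-≡ X =
  cong suc (length-filter-cyclic P? X cl n (next X) vs q hs n≤)
... | no ¬Pv rewrite indicator-≢ X p (λ p≡X → ¬Pv (Equivalence.from (cl p v h) p≡X)) =
  length-filter-cyclic P? X cl n (next p) vs q hs n≤

length-concatMap-children : ∀ vs → length (concatMap children vs) ≡ length vs + length vs
length-concatMap-children []       = refl
length-concatMap-children (v ∷ vs) =
  cong suc (trans (cong suc (length-concatMap-children vs)) (sym (ℕ.+-suc (length vs) (length vs))))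

1≤length-cwRow : ∀ r → 1 ≤ length (cwRow r)
1≤length-cwRow zero    = s≤s z≤n
1≤length-cwRow (suc r) = subst (1 ≤_) (sym (length-concatMap-children (cwRow r)))
  (ℕ.≤-trans (1≤length-cwRow r) (ℕ.m≤m+n _ _))

suc≤length-cwRowsUpTo : ∀ r → suc r ≤ length (cwRowsUpTo r)
suc≤length-cwRowsUpTo zero    = s≤s z≤n
suc≤length-cwRowsUpTo (suc r) = subst (suc (suc r) ≤_) (sym (length-++ (cwRowsUpTo r)))
  (subst (_≤ length (cwRowsUpTo r) + length (cwRow (suc r))) (ℕ.+-comm (suc r) 1)
    (ℕ.+-mono-≤ (suc≤length-cwRowsUpTo r) (1≤length-cwRow (suc r))))

countIn≡occurrences : {P : Pred ℚ 0ℓ} (P? : Decidable P) (X : Parity) → Classifies P X →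
  ∀ n → countIn P? n ≡ occurrences X odd n
countIn≡occurrences P? X cl n = length-filter-cyclic P? X cl n odd (cwRowsUpTo n) _ (cyclic-cwRowsUpTo n)
  (ℕ.≤-trans (ℕ.n≤1+n n) (suc≤length-cwRowsUpTo n))

nodeℚ-reduced : ∀ {a b} (cop : Coprime (suc a) (suc b)) → nodeℚ (a , b) ≡ mkℚ (+ suc a) b cop
nodeℚ-reduced cop = ℚ.normalize-coprime cop

classifies-even : Classifies IsEvenQ even
classifies-even p (a , b) (cop , h) rewrite nodeℚ-reduced cop = hasParity-even p h

classifies-odd : Classifies IsOddQ odd
classifies-odd p (a , b) (cop , h) rewrite nodeℚ-reduced cop = hasParity-odd p h

classifies-none : Classifies IsNoneQ none
classifies-none p (a , b) (cop , h) rewrite nodeℚ-reduced cop = hasParity-none p h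

∣m⊖n∣≤o : ∀ {m n o} → m ≤ o + n → n ≤ o + m → ℤ.∣ m ℤ.⊖ n ∣ ≤ o
∣m⊖n∣≤o {m} {n} {o} m≤o+n n≤o+m with ℕ.≤-total m n
... | inj₁ m≤n = subst (_≤ o) (sym (ℤ.∣⊖∣-≤ m≤n))
  (ℕ.m≤n+o⇒m∸n≤o n m (subst (n ≤_) (ℕ.+-comm o m) n≤o+m))
... | inj₂ n≤m = subst (_≤ o) (sym (trans (ℤ.∣m⊖n∣≡∣n⊖m∣ m n) (ℤ.∣⊖∣-≤ n≤m)))
  (ℕ.m≤n+o⇒m∸n≤o m n (subst (m ≤_) (ℕ.+-comm o n) m≤o+n))

small-error : ∀ {a d k} p → a ≤ 2 → d ≤ k → a * suc d <ℕ suc p * (suc k * 3)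
small-error {a} {d} {k} p a≤2 d≤k = begin-strict
  a * suc d         ≤⟨ ℕ.*-monoˡ-≤ (suc d) a≤2 ⟩
  2 * suc d         <⟨ ℕ.m<n+m (2 * suc d) (s≤s z≤n) ⟩
  3 * suc d         ≤⟨ ℕ.*-monoʳ-≤ 3 (s≤s d≤k) ⟩
  3 * suc k         ≡⟨ ℕ.*-comm 3 (suc k) ⟩
  suc k * 3         ≤⟨ ℕ.m≤n*m (suc k * 3) (suc p) ⟩
  suc p * (suc k * 3) ∎
  where open ℕ.≤-Reasoning

toℚᵘ-distance : ∀ x y → toℚᵘ ∣ x - y ∣ ℚᵘ.≃ ℚᵘ.∣ toℚᵘ x ℚᵘ.- toℚᵘ y ∣
toℚᵘ-distance x y = ℚᵘ.≃-trans (ℚ.toℚᵘ-homo-∣-∣ (x - y))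
  (ℚᵘ.∣-∣-cong (ℚᵘ.≃-trans (ℚ.toℚᵘ-homo-+ x (- y))
                           (ℚᵘ.+-cong (ℚᵘ.≃-refl {toℚᵘ x}) (ℚ.toℚᵘ-homo‿- y))))

toℚᵘ-distance-⅓ : ∀ c k →
  toℚᵘ ∣ + c / suc k - + 1 / 3 ∣ ℚᵘ.≃ ℚᵘ.∣ ℚᵘ.mkℚᵘ (+ c) k ℚᵘ.- ℚᵘ.mkℚᵘ (+ 1) 2 ∣
toℚᵘ-distance-⅓ c k = ℚᵘ.≃-trans (toℚᵘ-distance (+ c / suc k) (+ 1 / 3))
  (ℚᵘ.∣-∣-cong (ℚᵘ.+-cong (ℚ.toℚᵘ-fromℚᵘ (ℚᵘ.mkℚᵘ (+ c) k))
                           (ℚᵘ.-‿cong (ℚ.toℚᵘ-fromℚᵘ (ℚᵘ.mkℚᵘ (+ 1) 2)))))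

distance-⅓-numerator : ∀ c k → + c ℤ.* + 3 ℤ.+ ℤ.-[1+ 0 ] ℤ.* + suc k ≡ c * 3 ℤ.⊖ suc k
distance-⅓-numerator c k =
  trans (cong₂ ℤ._+_ (sym (ℤ.pos-* c 3)) (ℤ.-1*i≡-i (+ suc k))) (ℤ.m-n≡m⊖n (c * 3) (suc k))

-- In ℚᵘ, where mkℚᵘ n k stands for n/(k+1), the distance is literally |3c − (k+1)|/(3(k+1)),
-- so after cross-multiplication with ε = (p+1)/(d+1) the claim becomes small-error.
distance-⅓<ε : ∀ c k → NearThird (suc k) c → ∀ p d .(cop : Coprime (suc p) (suc d)) → d ≤ k →
  ∣ + c / suc k - + 1 / 3 ∣ < mkℚ (+ suc p) d cop
distance-⅓<ε c k (lower , upper) p d cop d≤k =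
  ℚ.toℚᵘ-cancel-< (ℚᵘ.<-respˡ-≃ (ℚᵘ.≃-sym (toℚᵘ-distance-⅓ c k)) (ℚᵘ.*<* (subst₂ ℤ._<_
    (ℤ.pos-* error (suc d)) (ℤ.pos-* (suc p) (suc k * 3)) (ℤ.+<+ (small-error p error≤2 d≤k)))))
  where
  error : ℕ
  error = ℤ.∣ + c ℤ.* + 3 ℤ.+ ℤ.-[1+ 0 ] ℤ.* + suc k ∣

  error≤2 : error ≤ 2
  error≤2 = subst (_≤ 2) (sym (cong ℤ.∣_∣ (distance-⅓-numerator c k))) (∣m⊖n∣≤o upper lower)

density-⅓ : {P : Pred ℚ 0ℓ} (P? : Decidable P) (X : Parity) → Classifies P X →
  (ε : ℚ) → Positive ε → ∃[ N ] ((k : ℕ) → N ≤ k →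
    ∣ (+ countIn P? (suc k)) / suc k - + 1 / 3 ∣ < ε)
density-⅓ P? X cl (mkℚ ℤ.+[1+ p ] d cop) _ = d , λ k d≤k →
  subst (λ c → ∣ (+ c) / suc k - + 1 / 3 ∣ < mkℚ ℤ.+[1+ p ] d cop)
    (sym (countIn≡occurrences P? X cl (suc k)))
    (distance-⅓<ε (occurrences X odd (suc k)) k (occurrences-nearThird X odd (suc k)) p d cop d≤k)

parity-partition : (q : ℚ) →
  (IsEvenQ q ⊎ IsOddQ q ⊎ IsNoneQ q)
  × ¬ (IsEvenQ q × IsOddQ q)
  × ¬ (IsEvenQ q × IsNoneQ q)
  × ¬ (IsOddQ q × IsNoneQ q)
parity-partition q@(mkℚ _ _ cop) = covers , (λ (2∣m , 2∤m , _) → 2∤m 2∣m) , even-not-none ,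
  (λ ((_ , 2∤n) , 2∣n) → 2∤n 2∣n)
  where
  covers : IsEvenQ q ⊎ IsOddQ q ⊎ IsNoneQ q
  covers with isEvenQ? q | isNoneQ? q
  ... | yes 2∣m | _       = inj₁ 2∣m
  ... | no 2∤m  | yes 2∣n = inj₂ (inj₂ 2∣n)
  ... | no 2∤m  | no 2∤n  = inj₂ (inj₁ (2∤m , 2∤n))

  even-not-none : ¬ (IsEvenQ q × IsNoneQ q)
  even-not-none 2∣m×2∣n with Coprime.recompute cop 2∣m×2∣n
  ... | ()

theorem1 :
  ((q : ℚ) → Positive q →
    (IsEvenQ q ⊎ IsOddQ q ⊎ IsNoneQ q)
    × ¬ (IsEvenQ q × IsOddQ q)
    × ¬ (IsEvenQ q × IsNoneQ q)
    × ¬ (IsOddQ q × IsNoneQ q))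
  × ((ε : ℚ) → Positive ε → ∃[ N ] ((k : ℕ) → N ≤ k →
      ∣ (+ countIn isEvenQ? (suc k)) / suc k - + 1 / 3 ∣ < ε))
  × ((ε : ℚ) → Positive ε → ∃[ N ] ((k : ℕ) → N ≤ k →
      ∣ (+ countIn isOddQ? (suc k)) / suc k - + 1 / 3 ∣ < ε))
  × ((ε : ℚ) → Positive ε → ∃[ N ] ((k : ℕ) → N ≤ k →
      ∣ (+ countIn isNoneQ? (suc k)) / suc k - + 1 / 3 ∣ < ε))
theorem1 =
    (λ q _ → parity-partition q)
  , density-⅓ isEvenQ? even classifies-even
  , density-⅓ isOddQ?  odd  classifies-odd
  , density-⅓ isNoneQ? none classifies-none
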